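{- Let $G$ be a finite, connected, simple undirected graph with vertex set $V=\{v_0,\dots,v_n\}$ and edge set $E$, with sink $v_0$, and let $\widetilde V=V\setminus\{v_0\}$. Order superstable configurations on $G$ componentwise, let $\mathcal{S}_{\max}$ denote the set of maximal quasi-superstable divisors on $G$ (componentwise order), and let $g=|E|-|V|+1$. Let $\tilde c$ be a superstable configuration on $G$. Then: (1) $\tilde c$ is maximal among superstable configurations on $G$ if and only if $\tilde c-v_0\in\widetilde{\mathcal{S}}_0\cap\mathcal{S}_{\max}$; (2) $\deg(\tilde c):=\sum_{v\in\widetilde V}\tilde c_v\le g$, with equality if and only if $\tilde c$ is maximal.
   Context: For a graph $H$ with a chosen sink, a configuration $c\ge0$ (integer vector on the nonsink vertices) is superstable if no nonempty set $Y$ of nonsink vertices satisfies $c-\widetilde{\Delta}1_Y\ge0$, where $\widetilde{\Delta}$ is the Laplacian $D-A$ of $H$ with the sink's row and column removed. Configurations on $G$ are elements of $\mathbb{Z}\widetilde V\subseteq\mathbb{Z}V$. $K(G)$ is $G$ plus a new sink vertex $\tilde q$ adjacent to every vertex of $V$. The set $\mathcal{S}$ of quasi-superstable divisors consists of all $c\in\mathbb{Z}V$ with $c+1_V$ superstable on $K(G)$, $1_V=\sum_{v\in V}v$. $\widetilde{\mathcal{S}}_0=\{c\in\mathcal{S}:c_{v_0}=-1,\ c+v_0\ge0\}$. -}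

module Defs where

open import Data.Nat as ℕ using (ℕ; zero; suc)
open import Data.Integer as ℤ using (ℤ; +_; _+_; _-_; _*_; -_; _≤_)
open import Data.Fin using (Fin; zero; suc; _<?_)
open import Data.Bool using (Bool; true; false; if_then_else_; _∧_)
open import Data.Product using (Σ; ∃; _×_)
open import Relation.Nullary using (¬_)
open import Relation.Nullary.Decidable using (⌊_⌋)
open import Relation.Binary.PropositionalEquality using (_≡_; refl)

∑ : ∀ {m} → (Fin m → ℤ) → ℤ
∑ {zero} f = + 0
∑ {suc m} f = f zero + ∑ (λ i → f (suc i))

[_] : Bool → ℤ
[ b ] = if b then + 1 else + 0

record Graph (N : ℕ) : Set where
  field
    adj    : Fin N → Fin N → Bool
    sym    : ∀ i j → adj i j ≡ adj j i
    irrefl : ∀ i → adj i i ≡ false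
open Graph public

data Reach {N} (G : Graph N) : Fin N → Fin N → Set where
  here : ∀ {i} → Reach G i i
  step : ∀ {i j k} → adj G i j ≡ true → Reach G j k → Reach G i k

Connected : ∀ {N} → Graph N → Set
Connected G = ∀ i j → Reach G i j

degree : ∀ {N} → Graph N → Fin N → ℤ
degree G w = ∑ (λ u → [ adj G w u ])

edgeCount : ∀ {N} → Graph N → ℤ
edgeCount G = ∑ (λ i → ∑ (λ j → [ ⌊ i <? j ⌋ ∧ adj G i j ]))

genus : ∀ {N} → Graph N → ℤ
genus {N} G = edgeCount G - + N + + 1

-- Throughout, the sink of a graph on Fin (suc m) is `zero`, and
-- configurations are vectors on the nonsink vertices, indexed by Fin m
-- (nonsink vertex i corresponds to suc i).

redLap : ∀ {m} → Graph (suc m) → (Fin m → ℤ) → Fin m → ℤ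
redLap H x v = degree H (suc v) * x v - ∑ (λ u → [ adj H (suc v) (suc u) ] * x u)

indicator : ∀ {m} → (Fin m → Bool) → Fin m → ℤ
indicator Y v = [ Y v ]

Nonempty : ∀ {m} → (Fin m → Bool) → Set
Nonempty Y = ∃ λ v → Y v ≡ true

Superstable : ∀ {m} → Graph (suc m) → (Fin m → ℤ) → Set
Superstable H c =
  (∀ v → + 0 ≤ c v) ×
  ¬ (Σ (Fin _ → Bool) λ Y → Nonempty Y × (∀ v → + 0 ≤ c v - redLap H (indicator Y) v))

_≤ᶜ_ : ∀ {m} → (Fin m → ℤ) → (Fin m → ℤ) → Set
c ≤ᶜ d = ∀ v → c v ≤ d v

_≈ᶜ_ : ∀ {m} → (Fin m → ℤ) → (Fin m → ℤ) → Set
c ≈ᶜ d = ∀ v → c v ≡ d v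

Maximal : ∀ {m} → ((Fin m → ℤ) → Set) → (Fin m → ℤ) → Set
Maximal P c = P c × (∀ d → P d → c ≤ᶜ d → d ≈ᶜ c)

-- K(G): new sink q̃ = zero, adjacent to every vertex of G (vertex i of G is suc i).
kAdj : ∀ {N} → Graph N → Fin (suc N) → Fin (suc N) → Bool
kAdj G zero zero = false
kAdj G zero (suc j) = true
kAdj G (suc i) zero = true
kAdj G (suc i) (suc j) = adj G i j

kSym : ∀ {N} (G : Graph N) i j → kAdj G i j ≡ kAdj G j i
kSym G zero zero = refl
kSym G zero (suc j) = refl
kSym G (suc i) zero = refl
kSym G (suc i) (suc j) = sym G i j

kIrr : ∀ {N} (G : Graph N) i → kAdj G i i ≡ false
kIrr G zero = refl
kIrr G (suc i) = irrefl G i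

K : ∀ {N} → Graph N → Graph (suc N)
K G = record { adj = kAdj G ; sym = kSym G ; irrefl = kIrr G }

-- Divisors on G are vectors indexed by all vertices Fin (suc n); v₀ = zero.
one : ∀ {N} → Fin N → ℤ
one v = + 1

QuasiSuperstable : ∀ {N} → Graph N → (Fin N → ℤ) → Set
QuasiSuperstable G c = Superstable (K G) (λ v → c v + + 1)

MaxQuasiSuperstable : ∀ {N} → Graph N → (Fin N → ℤ) → Set
MaxQuasiSuperstable G = Maximal (QuasiSuperstable G)

addV0 : ∀ {n} → (Fin (suc n) → ℤ) → ℤ → Fin (suc n) → ℤ
addV0 c k zero = c zero + k
addV0 c k (suc i) = c (suc i)

S0 : ∀ {n} → Graph (suc n) → (Fin (suc n) → ℤ) → Set
S0 G c = QuasiSuperstable G c × (c zero ≡ - + 1) × (∀ v → + 0 ≤ addV0 c (+ 1) v)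

toDiv : ∀ {n} → (Fin n → ℤ) → Fin (suc n) → ℤ
toDiv c zero = + 0
toDiv c (suc i) = c i

MaxSuperstable : ∀ {n} → Graph (suc n) → (Fin n → ℤ) → Set
MaxSuperstable G = Maximal (Superstable G)

deg : ∀ {n} → (Fin n → ℤ) → ℤ
deg c = ∑ c

module Submission where

-- Proof idea: Dhar's burning algorithm, counted along the edges.
--
-- Let H be a graph with sink and m nonsink vertices.  A configuration c ≥ 0 is
-- superstable iff all nonsink vertices can be burnt one at a time, each vertex
-- having fewer chips than edges leading out of the unburnt set (Burning).
-- Each burnt vertex v has c v + 1 ≤ #edges leaving, and these edges are exactly
-- those lost when v leaves the unburnt set; hence 2 Σ_U (c + 1) is at most the
-- number of ordered adjacent pairs touching U (burn-bound), and for the full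
-- set deg c + m ≤ |E(H)|.  If this is strict, some vertex takes one more chip
-- and everything still burns, so c is not maximal (burn-bump); if it is an
-- equality, every superstable d ≥ c has deg d ≤ deg c, so d = c.  Thus
--     c maximal  ⇔  deg c + m = |E(H)|          (maximal⇔tight).
-- The corollary applies this to c on G, where |E| - n = g gives part (2),
-- and to lift c = c - v₀ + 1_V on K(G): lift c is superstable, and its
-- tightness equation is that of c shifted by n + 1, since K(G) has n + 1
-- more edges.  Maximality of lift c is maximality of the quasi-superstable
-- c - v₀ after translating by 1_V (maximal-shift), which gives part (1).

open import Defs hiding (sym)
open import Data.Nat as ℕ using (ℕ; zero; suc; z≤n)
import Data.Nat.Properties as ℕP
open import Data.Integer as ℤ using (ℤ; +_; -_; _+_; _-_; _*_; _≤_; _<_; +≤+)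
import Data.Integer.Properties as ℤP
open import Data.Integer.Tactic.RingSolver using (solve-∀)
open import Algebra.Bundles using (AbelianGroup)
open import Algebra.Properties.Group (AbelianGroup.group ℤP.+-0-abelianGroup) using (∙-cancelʳ)
open import Algebra.Properties.CommutativeSemigroup ℤP.+-commutativeSemigroup using (interchange)
open import Data.Fin using (Fin; zero; suc; _<?_)
open import Data.Fin.Properties using (_≟_; any?; <-cmp; <-asym)
open import Data.Bool using (Bool; true; false; if_then_else_; _∧_; _∨_; not)
import Data.Bool.Properties as BoolP
open import Data.Product using (Σ; _×_; _,_; proj₁; proj₂)
open import Data.Empty using (⊥; ⊥-elim)
open import Function.Bundles using (_⇔_; mk⇔; Equivalence)
import Function.Properties.Equivalence as ⇔
open import Relation.Binary.Definitions using (tri<; tri≈; tri>)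
open import Relation.Nullary using (¬_; yes; no; does; contradiction)
open import Relation.Nullary.Decidable using (⌊_⌋; _×-dec_; dec-true; dec-false)
open import Relation.Binary.PropositionalEquality hiding ([_])

halve-≤ : ∀ {x y} → x + x ≤ y + y → x ≤ y
halve-≤ p = ℤP.≮⇒≥ (λ y<x → ℤP.≤⇒≯ p (ℤP.+-mono-< y<x y<x))

halve-≡ : ∀ {x y} → x + x ≡ y + y → x ≡ y
halve-≡ p = ℤP.≤-antisym (halve-≤ (ℤP.≤-reflexive p)) (halve-≤ (ℤP.≤-reflexive (sym p)))

+-cancelʳ-≤ : ∀ k {a b} → a + k ≤ b + k → a ≤ b
+-cancelʳ-≤ k p = ℤP.≮⇒≥ (λ b<a → ℤP.≤⇒≯ p (ℤP.+-monoˡ-< k b<a))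

+-cancelʳ-⇔ : ∀ k {a b} → (a ≡ b) ⇔ (a + k ≡ b + k)
+-cancelʳ-⇔ k {a} {b} = mk⇔ (cong (λ z → z + k)) (∙-cancelʳ k a b)

<⇒+1≤ : ∀ {x y} → x < y → x + + 1 ≤ y
<⇒+1≤ {x} p = subst (_≤ _) (ℤP.+-comm (+ 1) x) (ℤP.i<j⇒suc[i]≤j p)

x+1≢x : ∀ x → x + + 1 ≢ x
x+1≢x x eq = ℤP.i≢suc[i] (sym (trans (ℤP.+-comm (+ 1) x) eq))

∑-cong : ∀ {k} {f g : Fin k → ℤ} → (∀ i → f i ≡ g i) → ∑ f ≡ ∑ g
∑-cong {zero} h = refl
∑-cong {suc k} h = cong₂ _+_ (h zero) (∑-cong (λ i → h (suc i)))

∑-+ : ∀ {k} (f g : Fin k → ℤ) → ∑ (λ i → f i + g i) ≡ ∑ f + ∑ g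
∑-+ {zero} f g = refl
∑-+ {suc k} f g = trans (cong (_+_ (f zero + g zero)) (∑-+ (λ i → f (suc i)) (λ i → g (suc i))))
                       (interchange (f zero) (g zero) _ _)

∑-zero : ∀ {k} → ∑ {k} (λ _ → + 0) ≡ + 0
∑-zero {zero} = refl
∑-zero {suc k} = trans (ℤP.+-identityˡ _) (∑-zero {k})

∑-one : ∀ {k} → ∑ {k} (λ _ → + 1) ≡ + k
∑-one {zero} = refl
∑-one {suc k} = cong (_+_ (+ 1)) (∑-one {k})

∑-mono : ∀ {k} {f g : Fin k → ℤ} → (∀ i → f i ≤ g i) → ∑ f ≤ ∑ g
∑-mono {zero} h = ℤP.≤-refl
∑-mono {suc k} h = ℤP.+-mono-≤ (h zero) (∑-mono (λ i → h (suc i)))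

∑-nonneg : ∀ {k} {f : Fin k → ℤ} → (∀ i → + 0 ≤ f i) → + 0 ≤ ∑ f
∑-nonneg {k} {f} h = subst (λ z → z ≤ ∑ f) (∑-zero {k}) (∑-mono h)

∑-swap : ∀ {k l} (f : Fin k → Fin l → ℤ) → ∑ (λ i → ∑ (f i)) ≡ ∑ (λ j → ∑ (λ i → f i j))
∑-swap {zero} {l} f = sym (∑-zero {l})
∑-swap {suc k} f = trans (cong (_+_ (∑ (f zero))) (∑-swap (λ i → f (suc i))))
                         (sym (∑-+ (f zero) (λ j → ∑ (λ i → f (suc i) j))))

∑-if : ∀ {k} (b : Bool) (f : Fin k → ℤ) → ∑ (λ j → if b then f j else + 0) ≡ (if b then ∑ f else + 0)
∑-if true f = refl
∑-if {k} false f = ∑-zero {k}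

∑-delta : ∀ {k} (w : Fin k) (g : Fin k → ℤ) → ∑ (λ i → if does (i ≟ w) then g i else + 0) ≡ g w
∑-delta {suc k} zero g = trans (cong (_+_ (g zero)) (∑-zero {k})) (ℤP.+-identityʳ (g zero))
∑-delta {suc k} (suc w) g = trans (ℤP.+-identityˡ _) (∑-delta w (λ i → g (suc i)))

∑-tight : ∀ {k} {f g : Fin k → ℤ} → (∀ i → f i ≤ g i) → ∑ g ≤ ∑ f → ∀ i → f i ≡ g i
∑-tight {suc k} h s zero =
  ℤP.≤-antisym (h zero) (ℤP.≮⇒≥ (λ f₀<g₀ → ℤP.≤⇒≯ s (ℤP.+-mono-<-≤ f₀<g₀ (∑-mono (λ i → h (suc i))))))
∑-tight {suc k} h s (suc i) =
  ∑-tight (λ i → h (suc i)) (ℤP.≮⇒≥ (λ lt → ℤP.≤⇒≯ s (ℤP.+-mono-≤-< (h zero) lt))) i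

[]-nonneg : ∀ b → + 0 ≤ [ b ]
[]-nonneg true = +≤+ z≤n
[]-nonneg false = +≤+ z≤n

[]-∧-true : ∀ a → [ a ∧ true ] ≡ [ a ]
[]-∧-true true = refl
[]-∧-true false = refl

[]-split : ∀ a b → [ a ∧ not b ] + [ a ] * [ b ] ≡ [ a ]
[]-split true true = refl
[]-split true false = refl
[]-split false true = refl
[]-split false false = refl

[]-*-nonneg : ∀ a b → + 0 ≤ [ a ] * [ b ]
[]-*-nonneg true b = subst (_≤_ (+ 0)) (sym (ℤP.*-identityˡ [ b ])) ([]-nonneg b)
[]-*-nonneg false b = ℤP.≤-refl

_⊆_ : ∀ {m} → (Fin m → Bool) → (Fin m → Bool) → Set
Y ⊆ U = ∀ u → Y u ≡ true → U u ≡ true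

full : ∀ {m} → Fin m → Bool
full _ = true

ext : ∀ {m} → (Fin m → Bool) → Fin (suc m) → Bool
ext U zero = false
ext U (suc u) = U u

rem : ∀ {m} → (Fin m → Bool) → Fin m → Fin m → Bool
rem U v u = if does (u ≟ v) then false else U u

rem-self : ∀ {m} (U : Fin m → Bool) v → rem U v v ≡ false
rem-self U v rewrite dec-true (v ≟ v) refl = refl

rem-⊆ : ∀ {m} (U : Fin m → Bool) v → rem U v ⊆ U
rem-⊆ U v u ru with u ≟ v
... | yes _ = contradiction ru λ ()
... | no _ = ru

rem-≢ : ∀ {m} (U : Fin m → Bool) {u v} → rem U v u ≡ true → u ≢ v
rem-≢ U {u} ru refl = contradiction (trans (sym ru) (rem-self U u)) λ ()

size : ∀ {m} → (Fin m → Bool) → ℕ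
size {zero} U = 0
size {suc m} U = (if U zero then 1 else 0) ℕ.+ size (λ u → U (suc u))

size-rem : ∀ {m} (U : Fin m → Bool) v → U v ≡ true → size U ≡ suc (size (rem U v))
size-rem U zero uv rewrite uv = refl
size-rem U (suc v) uv =
  trans (cong (ℕ._+_ (if U zero then 1 else 0)) (size-rem (λ u → U (suc u)) v uv))
        (ℕP.+-suc (if U zero then 1 else 0) _)

size-full : ∀ m → size (full {m}) ≡ m
size-full zero = refl
size-full (suc m) = cong suc (size-full m)

size-zero : ∀ {m} (U : Fin m → Bool) → size U ≡ 0 → ∀ u → U u ≡ false
size-zero U s u with U u in uu
... | false = refl
... | true with () ← trans (sym s) (size-rem U u uu)

-- Number of neighbours of the nonsink vertex v (in H) lying outside U; the sink always counts.
out : ∀ {m} → Graph (suc m) → (Fin m → Bool) → Fin m → ℤ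
out H U v = ∑ (λ w → [ adj H (suc v) w ∧ not (ext U w) ])

module _ {m} (H : Graph (suc m)) where

  inside : (Fin m → Bool) → Fin m → ℤ
  inside Y v = ∑ (λ u → [ adj H (suc v) (suc u) ] * [ Y u ])

  degree-split : ∀ Y v → degree H (suc v) ≡ out H Y v + inside Y v
  degree-split Y v = begin
      [ adj H (suc v) zero ] + ∑ (λ u → [ adj H (suc v) (suc u) ])
    ≡⟨ cong₂ _+_ (sym ([]-∧-true (adj H (suc v) zero)))
                 (trans (∑-cong (λ u → sym ([]-split (adj H (suc v) (suc u)) (Y u))))
                        (∑-+ (λ u → [ adj H (suc v) (suc u) ∧ not (Y u) ]) (λ u → [ adj H (suc v) (suc u) ] * [ Y u ]))) ⟩
      [ adj H (suc v) zero ∧ true ] + (∑ (λ u → [ adj H (suc v) (suc u) ∧ not (Y u) ]) + inside Y v)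
    ≡⟨ sym (ℤP.+-assoc [ adj H (suc v) zero ∧ true ] (∑ (λ u → [ adj H (suc v) (suc u) ∧ not (Y u) ])) (inside Y v)) ⟩
      out H Y v + inside Y v ∎
    where open ≡-Reasoning

  redLap-inside : ∀ Y v → Y v ≡ true → redLap H (indicator Y) v ≡ out H Y v
  redLap-inside Y v yv rewrite yv =
    trans (cong (λ d → d * + 1 - inside Y v) (degree-split Y v)) (cancel (out H Y v) (inside Y v))
    where cancel : ∀ o i → (o + i) * + 1 - i ≡ o
          cancel = solve-∀

  redLap-outside : ∀ Y v → Y v ≡ false → redLap H (indicator Y) v ≤ + 0
  redLap-outside Y v yv rewrite yv =
    subst (_≤ + 0) (sym (annihilate (degree H (suc v)) (inside Y v)))
          (ℤP.neg-mono-≤ (∑-nonneg (λ u → []-*-nonneg (adj H (suc v) (suc u)) (Y u))))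
    where annihilate : ∀ d i → d * + 0 - i ≡ - i
          annihilate = solve-∀

  CanFire : (Fin m → ℤ) → (Fin m → Bool) → Set
  CanFire c Y = ∀ v → Y v ≡ true → out H Y v ≤ c v

  legal⇒canFire : ∀ {c} Y → (∀ v → + 0 ≤ c v - redLap H (indicator Y) v) → CanFire c Y
  legal⇒canFire {c} Y legal v yv =
    subst (_≤ c v) (redLap-inside Y v yv) (ℤP.0≤i-j⇒j≤i (legal v))

  canFire⇒legal : ∀ {c} Y → (∀ v → + 0 ≤ c v) → CanFire c Y → ∀ v → + 0 ≤ c v - redLap H (indicator Y) v
  canFire⇒legal {c} Y c≥0 fire v = ℤP.i≤j⇒0≤j-i (by-membership (Y v) refl)
    where
      by-membership : ∀ b → Y v ≡ b → redLap H (indicator Y) v ≤ c v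
      by-membership true yv = subst (_≤ c v) (sym (redLap-inside Y v yv)) (fire v yv)
      by-membership false yv = ℤP.≤-trans (redLap-outside Y v yv) (c≥0 v)

  superstable-resp : ∀ {c d} → c ≈ᶜ d → Superstable H c → Superstable H d
  superstable-resp c≈d (c≥0 , stuck) =
    (λ v → subst (_≤_ (+ 0)) (c≈d v) (c≥0 v)) ,
    λ { (Y , ne , legal) → stuck (Y , ne , λ v → subst (λ z → + 0 ≤ z - redLap H (indicator Y) v) (sym (c≈d v)) (legal v)) }

-- Counting edges

∑∑ : ∀ {k} → (Fin k → Fin k → ℤ) → ℤ
∑∑ f = ∑ (λ i → ∑ (f i))

∑∑-+ : ∀ {k} (f g : Fin k → Fin k → ℤ) → ∑∑ (λ i j → f i j + g i j) ≡ ∑∑ f + ∑∑ g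
∑∑-+ f g = trans (∑-cong (λ i → ∑-+ (f i) (g i))) (∑-+ (λ i → ∑ (f i)) (λ i → ∑ (g i)))

arcs : ∀ {N} → Graph N → ℤ
arcs H = ∑∑ (λ i j → [ adj H i j ])

-- Each edge {i, j} is one ordered pair with i < j and one with j < i.
arcs-edgeCount : ∀ {N} (H : Graph N) → arcs H ≡ edgeCount H + edgeCount H
arcs-edgeCount H = begin
    arcs H
  ≡⟨ ∑-cong (λ i → ∑-cong (orient i)) ⟩
    ∑∑ (λ i j → [ ⌊ i <? j ⌋ ∧ adj H i j ] + [ ⌊ j <? i ⌋ ∧ adj H i j ])
  ≡⟨ ∑∑-+ (λ i j → [ ⌊ i <? j ⌋ ∧ adj H i j ]) (λ i j → [ ⌊ j <? i ⌋ ∧ adj H i j ]) ⟩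
    edgeCount H + ∑∑ (λ i j → [ ⌊ j <? i ⌋ ∧ adj H i j ])
  ≡⟨ cong (_+_ (edgeCount H)) (trans (∑-swap (λ i j → [ ⌊ j <? i ⌋ ∧ adj H i j ]))
       (∑-cong (λ j → ∑-cong (λ i → cong (λ b → [ ⌊ j <? i ⌋ ∧ b ]) (Graph.sym H i j))))) ⟩
    edgeCount H + edgeCount H ∎
  where
    open ≡-Reasoning
    orient : ∀ i j → [ adj H i j ] ≡ [ ⌊ i <? j ⌋ ∧ adj H i j ] + [ ⌊ j <? i ⌋ ∧ adj H i j ]
    orient i j with i <? j | j <? i
    ... | yes i<j | yes j<i = ⊥-elim (<-asym i<j j<i)
    ... | yes _ | no _ = sym (ℤP.+-identityʳ _)
    ... | no _ | yes _ = sym (ℤP.+-identityˡ _)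
    ... | no i≮j | no j≮i with <-cmp i j
    ...   | tri< i<j _ _ = contradiction i<j i≮j
    ...   | tri> _ _ j<i = contradiction j<i j≮i
    ...   | tri≈ _ refl _ rewrite irrefl H i = refl

-- In K(G) every vertex of G gains the new sink as a neighbour.
arcs-K : ∀ {N} (G : Graph N) → arcs (K G) ≡ arcs G + (+ N + + N)
arcs-K {N} G = begin
    (+ 0 + ∑ {N} (λ _ → + 1)) + ∑ (λ i → + 1 + ∑ (λ j → [ adj G i j ]))
  ≡⟨ cong₂ _+_ (cong (_+_ (+ 0)) (∑-one {N}))
               (trans (∑-+ (λ _ → + 1) (λ i → ∑ (λ j → [ adj G i j ]))) (cong (λ z → z + arcs G) (∑-one {N}))) ⟩
    (+ 0 + + N) + (+ N + arcs G)
  ≡⟨ rearrange (+ N) (arcs G) ⟩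
    arcs G + (+ N + + N) ∎
  where
    open ≡-Reasoning
    rearrange : ∀ n a → (+ 0 + n) + (n + a) ≡ a + (n + n)
    rearrange = solve-∀

edgeCount-K : ∀ {N} (G : Graph N) → edgeCount (K G) ≡ edgeCount G + + N
edgeCount-K {N} G = halve-≡ (begin
    edgeCount (K G) + edgeCount (K G)  ≡⟨ sym (arcs-edgeCount (K G)) ⟩
    arcs (K G)                         ≡⟨ arcs-K G ⟩
    arcs G + (+ N + + N)               ≡⟨ cong (λ a → a + (+ N + + N)) (arcs-edgeCount G) ⟩
    (edgeCount G + edgeCount G) + (+ N + + N)  ≡⟨ interchange (edgeCount G) (edgeCount G) (+ N) (+ N) ⟩
    (edgeCount G + + N) + (edgeCount G + + N) ∎)
  where open ≡-Reasoning

-- Case analysis of one ordered pair (i, j) when v leaves U; s and t say whether i resp. j is v,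
-- p and q whether i resp. j lies in U.  The pair either still touches U ∖ {v}, or it is
-- (v, w) or (w, v) with w ∉ U.
pair-split : ∀ a p q s t → (s ≡ true → p ≡ true) → (t ≡ true → q ≡ true) → (s ≡ true → t ≡ true → a ≡ false) →
  [ a ∧ (p ∨ q) ] ≡ [ a ∧ ((if s then false else p) ∨ (if t then false else q)) ]
                    + (if s then [ a ∧ not q ] else + 0) + (if t then [ a ∧ not p ] else + 0)
pair-split a p q true true _ _ loop rewrite loop refl refl = refl
pair-split a p q true false p-in _ _ rewrite p-in refl = first a q
  where first : ∀ a q → [ a ∧ true ] ≡ [ a ∧ (false ∨ q) ] + [ a ∧ not q ] + + 0
        first true true = refl
        first true false = refl
        first false q = refl
pair-split a p q false true _ q-in _ rewrite q-in refl = second a p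
  where second : ∀ a p → [ a ∧ (p ∨ true) ] ≡ [ a ∧ (p ∨ false) ] + + 0 + [ a ∧ not p ]
        second true true = refl
        second true false = refl
        second false p = refl
pair-split a p q false false _ _ _ = sym (trans (ℤP.+-identityʳ _) (ℤP.+-identityʳ _))

module _ {m} (H : Graph (suc m)) where

  -- Ordered adjacent pairs with an endpoint in U: twice the number of edges touching U.
  touching : (Fin m → Bool) → ℤ
  touching U = ∑∑ (λ i j → [ adj H i j ∧ (ext U i ∨ ext U j) ])

  touching-none : ∀ U → (∀ u → U u ≡ false) → touching U ≡ + 0
  touching-none U empty = trans (∑-cong (λ i → trans (∑-cong (λ j → no-pair i j)) (∑-zero {suc m}))) (∑-zero {suc m})
    where
      outside : ∀ i → ext U i ≡ false
      outside zero = refl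
      outside (suc u) = empty u
      no-pair : ∀ i j → [ adj H i j ∧ (ext U i ∨ ext U j) ] ≡ + 0
      no-pair i j rewrite outside i | outside j with adj H i j
      ... | true = refl
      ... | false = refl

  touching-full : touching full ≡ arcs H
  touching-full = ∑-cong (λ i → ∑-cong (λ j → all-pairs i j))
    where
      all-pairs : ∀ i j → [ adj H i j ∧ (ext full i ∨ ext full j) ] ≡ [ adj H i j ]
      all-pairs zero zero rewrite irrefl H zero = refl
      all-pairs zero (suc j) = []-∧-true (adj H zero (suc j))
      all-pairs (suc i) j = []-∧-true (adj H (suc i) j)

  -- Removing v from U loses exactly the pairs (v, w) and (w, v) with w ∉ U.
  touching-rem : ∀ U v → U v ≡ true → touching U ≡ touching (rem U v) + (out H U v + out H U v)
  touching-rem U v uv = begin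
      touching U
    ≡⟨ ∑-cong (λ i → ∑-cong (λ j → split i j)) ⟩
      ∑∑ (λ i j → (Rest i j + From i j) + To i j)
    ≡⟨ trans (∑∑-+ (λ i j → Rest i j + From i j) To) (cong (λ z → z + ∑∑ To) (∑∑-+ Rest From)) ⟩
      (touching (rem U v) + ∑∑ From) + ∑∑ To
    ≡⟨ trans (ℤP.+-assoc (touching (rem U v)) (∑∑ From) (∑∑ To)) (cong₂ (λ a b → touching (rem U v) + (a + b)) from-v to-v) ⟩
      touching (rem U v) + (out H U v + out H U v) ∎
    where
      open ≡-Reasoning
      is-v : Fin (suc m) → Bool
      is-v i = does (i ≟ suc v)
      Rest From To : Fin (suc m) → Fin (suc m) → ℤ
      Rest i j = [ adj H i j ∧ (ext (rem U v) i ∨ ext (rem U v) j) ]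
      From i j = if is-v i then [ adj H i j ∧ not (ext U j) ] else + 0
      To i j = if is-v j then [ adj H i j ∧ not (ext U i) ] else + 0
      ext-rem : ∀ i → ext (rem U v) i ≡ (if is-v i then false else ext U i)
      ext-rem zero = refl
      ext-rem (suc u) = refl
      v-in : ∀ i → is-v i ≡ true → ext U i ≡ true
      v-in i i-is-v with i ≟ suc v
      ... | yes refl = uv
      ... | no _ = contradiction i-is-v λ ()
      no-loop : ∀ i j → is-v i ≡ true → is-v j ≡ true → adj H i j ≡ false
      no-loop i j i-is-v j-is-v with i ≟ suc v | j ≟ suc v
      ... | yes refl | yes refl = irrefl H (suc v)
      ... | no _ | _ = contradiction i-is-v λ ()
      ... | yes _ | no _ = contradiction j-is-v λ ()
      split : ∀ i j → [ adj H i j ∧ (ext U i ∨ ext U j) ] ≡ (Rest i j + From i j) + To i j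
      split i j rewrite ext-rem i | ext-rem j =
        pair-split (adj H i j) (ext U i) (ext U j) (is-v i) (is-v j) (v-in i) (v-in j) (no-loop i j)
      from-v : ∑∑ From ≡ out H U v
      from-v = trans (∑-cong (λ i → ∑-if (is-v i) (λ j → [ adj H i j ∧ not (ext U j) ])))
                     (∑-delta (suc v) (λ i → ∑ (λ j → [ adj H i j ∧ not (ext U j) ])))
      to-v : ∑∑ To ≡ out H U v
      to-v = begin
          ∑∑ To
        ≡⟨ ∑-swap To ⟩
          ∑ (λ j → ∑ (λ i → To i j))
        ≡⟨ ∑-cong (λ j → ∑-if (is-v j) (λ i → [ adj H i j ∧ not (ext U i) ])) ⟩
          ∑ (λ j → if is-v j then ∑ (λ i → [ adj H i j ∧ not (ext U i) ]) else + 0)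
        ≡⟨ ∑-delta (suc v) (λ j → ∑ (λ i → [ adj H i j ∧ not (ext U i) ])) ⟩
          ∑ (λ i → [ adj H i (suc v) ∧ not (ext U i) ])
        ≡⟨ ∑-cong (λ i → cong (λ b → [ b ∧ not (ext U i) ]) (Graph.sym H i (suc v))) ⟩
          out H U v ∎

weight : ∀ {m} → (Fin m → ℤ) → (Fin m → Bool) → ℤ
weight c U = ∑ (λ u → if U u then c u + + 1 else + 0)

weight-none : ∀ {m} (c : Fin m → ℤ) U → (∀ u → U u ≡ false) → weight c U ≡ + 0
weight-none {m} c U empty = trans (∑-cong (λ u → cong (λ b → if b then c u + + 1 else + 0) (empty u))) (∑-zero {m})

weight-full : ∀ {m} (c : Fin m → ℤ) → weight c full ≡ deg c + + m
weight-full {m} c = trans (∑-+ c (λ _ → + 1)) (cong (_+_ (deg c)) (∑-one {m}))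

weight-rem : ∀ {m} (c : Fin m → ℤ) U v → U v ≡ true → weight c U ≡ weight c (rem U v) + (c v + + 1)
weight-rem c U v uv =
  trans (∑-cong split)
        (trans (∑-+ (λ u → if rem U v u then c u + + 1 else + 0) (λ u → if does (u ≟ v) then c u + + 1 else + 0))
               (cong (_+_ (weight c (rem U v))) (∑-delta v (λ u → c u + + 1))))
  where
    split : ∀ u → (if U u then c u + + 1 else + 0)
                ≡ (if rem U v u then c u + + 1 else + 0) + (if does (u ≟ v) then c u + + 1 else + 0)
    split u with u ≟ v
    ... | yes refl rewrite uv = sym (ℤP.+-identityˡ _)
    ... | no _ = sym (ℤP.+-identityʳ _)

weight-rem² : ∀ {m} (c : Fin m → ℤ) U v → U v ≡ true →
  weight c U + weight c U ≡ (weight c (rem U v) + weight c (rem U v)) + ((c v + + 1) + (c v + + 1))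
weight-rem² c U v uv =
  trans (cong₂ _+_ (weight-rem c U v uv) (weight-rem c U v uv))
        (interchange (weight c (rem U v)) (c v + + 1) (weight c (rem U v)) (c v + + 1))

bump : ∀ {m} → (Fin m → ℤ) → Fin m → Fin m → ℤ
bump c w u = if does (u ≟ w) then c u + + 1 else c u

bump-self : ∀ {m} (c : Fin m → ℤ) w → bump c w w ≡ c w + + 1
bump-self c w rewrite dec-true (w ≟ w) refl = refl

bump-other : ∀ {m} (c : Fin m → ℤ) {w u} → u ≢ w → bump c w u ≡ c u
bump-other c {w} {u} u≢w rewrite dec-false (u ≟ w) u≢w = refl

bump-≥ : ∀ {m} (c : Fin m → ℤ) w u → c u ≤ bump c w u
bump-≥ c w u with u ≟ w
... | yes _ = ℤP.i≤i+j (c u) (+ 1)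
... | no _ = ℤP.≤-refl

-- Dhar's burning algorithm

module Burning {m} (H : Graph (suc m)) where

  data Burnable (c : Fin m → ℤ) : (Fin m → Bool) → Set where
    none : ∀ {U} → (∀ u → U u ≡ false) → Burnable c U
    burn : ∀ {U} v → U v ≡ true → c v < out H U v → Burnable c (rem U v) → Burnable c U

  out-antitone : ∀ {Y U} → Y ⊆ U → ∀ v → out H U v ≤ out H Y v
  out-antitone {Y} {U} Y⊆U v = ∑-mono pointwise
    where
      pointwise : ∀ w → [ adj H (suc v) w ∧ not (ext U w) ] ≤ [ adj H (suc v) w ∧ not (ext Y w) ]
      pointwise zero = ℤP.≤-refl
      pointwise (suc u) with adj H (suc v) (suc u) | Y u in yu | U u in uu
      ... | false | _ | _ = ℤP.≤-refl
      ... | true | true | true = ℤP.≤-refl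
      ... | true | false | true = +≤+ z≤n
      ... | true | false | false = ℤP.≤-refl
      ... | true | true | false = contradiction (trans (sym (Y⊆U u yu)) uu) λ ()

  -- No nonempty subset of a burnable set can be fired: its first burnt vertex lacks chips.
  burnable⇒no-firing : ∀ {c U} → Burnable c U → ∀ Y → Y ⊆ U → Nonempty Y → ¬ CanFire H c Y
  burnable⇒no-firing (none empty) Y Y⊆U (u , yu) _ = contradiction (trans (sym (Y⊆U u yu)) (empty u)) λ ()
  burnable⇒no-firing {c} {U} (burn v uv lt B) Y Y⊆U ne fire with Y v in yv
  ... | true = ℤP.≤⇒≯ (ℤP.≤-trans (out-antitone Y⊆U v) (fire v yv)) lt
  ... | false = burnable⇒no-firing B Y Y⊆rem ne fire
    where
      Y⊆rem : Y ⊆ rem U v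
      Y⊆rem u yu with u ≟ v
      ... | yes refl = contradiction (trans (sym yu) yv) λ ()
      ... | no _ = Y⊆U u yu

  -- A superstable configuration burns every set, by induction on its size: either some
  -- vertex can burn, or the whole set could be fired.
  superstable⇒burnable : ∀ {c} → Superstable H c → ∀ k U → size U ≡ k → Burnable c U
  superstable⇒burnable _ zero U s = none (size-zero U s)
  superstable⇒burnable {c} (c≥0 , stuck) (suc k) U s
    with any? (λ v → (U v BoolP.≟ true) ×-dec (c v ℤP.<? out H U v))
  ... | yes (v , uv , lt) =
    burn v uv lt (superstable⇒burnable (c≥0 , stuck) k (rem U v) (ℕP.suc-injective (trans (sym (size-rem U v uv)) s)))
  ... | no cannot with any? (λ v → U v BoolP.≟ true)
  ...   | no empty = none (λ u → BoolP.¬-not (λ uu → empty (u , uu)))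
  ...   | yes nonempty = ⊥-elim (stuck (U , nonempty , canFire⇒legal H U c≥0 fire))
    where
      fire : CanFire H c U
      fire v uv = ℤP.≮⇒≥ (λ lt → cannot (v , uv , lt))

  burnable⇒superstable : ∀ {c} → (∀ v → + 0 ≤ c v) → Burnable c full → Superstable H c
  burnable⇒superstable c≥0 B =
    c≥0 , λ { (Y , ne , legal) → burnable⇒no-firing B Y (λ _ _ → refl) ne (legal⇒canFire H Y legal) }

  burnable-antitone : ∀ {c d U} → Burnable c U → (∀ u → U u ≡ true → d u ≤ c u) → Burnable d U
  burnable-antitone (none empty) _ = none empty
  burnable-antitone {U = U} (burn v uv lt B) d≤c =
    burn v uv (ℤP.≤-<-trans (d≤c v uv) lt) (burnable-antitone B (λ u ru → d≤c u (rem-⊆ U v u ru)))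

  -- Each burnt vertex v has c v + 1 ≤ out H U v, and those leaving edges are exactly the
  -- pairs lost from 'touching' (counted twice), so burning bounds the weight by the edges.
  burn-bound : ∀ {c U} → Burnable c U → weight c U + weight c U ≤ touching H U
  burn-bound {c} {U} (none empty)
    rewrite weight-none c U empty | touching-none H U empty = ℤP.≤-refl
  burn-bound {c} {U} (burn v uv lt B) = begin
      weight c U + weight c U
    ≡⟨ weight-rem² c U v uv ⟩
      (weight c (rem U v) + weight c (rem U v)) + ((c v + + 1) + (c v + + 1))
    ≤⟨ ℤP.+-mono-≤ (burn-bound B) (ℤP.+-mono-≤ (<⇒+1≤ lt) (<⇒+1≤ lt)) ⟩
      touching H (rem U v) + (out H U v + out H U v)
    ≡⟨ sym (touching-rem H U v uv) ⟩
      touching H U ∎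
    where open ℤP.≤-Reasoning

  -- If the bound is strict, some vertex of U can take an extra chip and U still burns:
  -- the first burnt vertex v with slack takes it.
  burn-bump : ∀ {c U} → Burnable c U → weight c U + weight c U < touching H U →
              Σ (Fin m) λ w → (U w ≡ true) × Burnable (bump c w) U
  burn-bump {c} {U} (none empty) slack
    rewrite weight-none c U empty | touching-none H U empty = ⊥-elim (ℤP.<-irrefl refl slack)
  burn-bump {c} {U} (burn v uv lt B) slack with c v + + 1 ℤP.<? out H U v
  ... | yes room = v , uv , burn v uv (subst (_< out H U v) (sym (bump-self c v)) room)
                                      (burnable-antitone B unchanged)
    where
      unchanged : ∀ u → rem U v u ≡ true → bump c v u ≤ c u
      unchanged u ru = ℤP.≤-reflexive (bump-other c (rem-≢ U ru))
  ... | no no-room with burn-bump B slack-rest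
    where
      -- v has no slack, so the whole slack lies in U ∖ {v}.
      slack-rest : weight c (rem U v) + weight c (rem U v) < touching H (rem U v)
      slack-rest = ℤP.≰⇒> λ tight → ℤP.<⇒≱ slack (begin
          touching H U
        ≡⟨ touching-rem H U v uv ⟩
          touching H (rem U v) + (out H U v + out H U v)
        ≤⟨ ℤP.+-mono-≤ tight (ℤP.+-mono-≤ (ℤP.≮⇒≥ no-room) (ℤP.≮⇒≥ no-room)) ⟩
          (weight c (rem U v) + weight c (rem U v)) + ((c v + + 1) + (c v + + 1))
        ≡⟨ sym (weight-rem² c U v uv) ⟩
          weight c U + weight c U ∎)
        where open ℤP.≤-Reasoning
  ... | w , rw , Bw = w , rem-⊆ U v w rw ,
        burn v uv (subst (_< out H U v) (sym (bump-other c (λ v≡w → rem-≢ U rw (sym v≡w)))) lt) Bw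

-- Superstable configurations on a graph with sink: the degree bound and maximality

module _ {m} (H : Graph (suc m)) where
  open Burning H

  doubled-bound : ∀ {c} → Superstable H c →
    (deg c + + m) + (deg c + + m) ≤ edgeCount H + edgeCount H
  doubled-bound {c} ss = begin
      (deg c + + m) + (deg c + + m)  ≡⟨ cong₂ _+_ (sym (weight-full c)) (sym (weight-full c)) ⟩
      weight c full + weight c full  ≤⟨ burn-bound (superstable⇒burnable ss m full (size-full m)) ⟩
      touching H full                ≡⟨ touching-full H ⟩
      arcs H                         ≡⟨ arcs-edgeCount H ⟩
      edgeCount H + edgeCount H ∎
    where open ℤP.≤-Reasoning

  superstable-bound : ∀ {c} → Superstable H c → deg c + + m ≤ edgeCount H
  superstable-bound ss = halve-≤ (doubled-bound ss)

  -- If the bound is strict, one more chip can be added somewhere, so c is not maximal.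
  maximal⇒tight : ∀ {c} → Maximal (Superstable H) c → deg c + + m ≡ edgeCount H
  maximal⇒tight {c} (ss , maximal) with deg c + + m ℤ.≟ edgeCount H
  ... | yes tight = tight
  ... | no loose = ⊥-elim (x+1≢x (c w) (trans (sym (bump-self c w)) (maximal (bump c w) bumped-ss (bump-≥ c w) w)))
    where
      slack : weight c full + weight c full < touching H full
      slack = subst₂ _<_ (cong₂ _+_ (sym (weight-full c)) (sym (weight-full c)))
                         (sym (trans (touching-full H) (arcs-edgeCount H)))
                         (ℤP.+-mono-< strict strict)
        where strict : deg c + + m < edgeCount H
              strict = ℤP.≤∧≢⇒< (superstable-bound ss) loose
      bumped : Σ (Fin m) λ w → (full w ≡ true) × Burnable (bump c w) full
      bumped = burn-bump (superstable⇒burnable ss m full (size-full m)) slack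
      w : Fin m
      w = proj₁ bumped
      bumped-ss : Superstable H (bump c w)
      bumped-ss = burnable⇒superstable (λ u → ℤP.≤-trans (proj₁ ss u) (bump-≥ c w u)) (proj₂ (proj₂ bumped))

  -- If the bound is attained, a superstable d ≥ c has deg d ≤ deg c, hence d = c.
  tight⇒maximal : ∀ {c} → Superstable H c → deg c + + m ≡ edgeCount H → Maximal (Superstable H) c
  tight⇒maximal {c} ss tight = ss , λ d ss-d c≤d u →
    sym (∑-tight c≤d (+-cancelʳ-≤ (+ m) (ℤP.≤-trans (superstable-bound ss-d) (ℤP.≤-reflexive (sym tight)))) u)

  maximal⇔tight : ∀ {c} → Superstable H c → Maximal (Superstable H) c ⇔ (deg c + + m ≡ edgeCount H)
  maximal⇔tight ss = mk⇔ maximal⇒tight (tight⇒maximal ss)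

maximal-shift : ∀ {k} (P : (Fin k → ℤ) → Set) → (∀ {c d} → c ≈ᶜ d → P c → P d) → ∀ t x →
  Maximal P (λ v → x v + t) ⇔ Maximal (λ d → P (λ v → d v + t)) x
maximal-shift P P-resp t x = mk⇔ to from
  where
    minus-plus : ∀ a t → (a - t) + t ≡ a
    minus-plus = solve-∀
    to : Maximal P (λ v → x v + t) → Maximal (λ d → P (λ v → d v + t)) x
    to (px , maximal) = px , λ d pd x≤d v →
      ∙-cancelʳ t (d v) (x v) (maximal (λ u → d u + t) pd (λ u → ℤP.+-monoˡ-≤ t (x≤d u)) v)
    from : Maximal (λ d → P (λ v → d v + t)) x → Maximal P (λ v → x v + t)
    from (px , maximal) = px , λ d pd x+t≤d v →
      let d-t = λ u → d u - t
          pd-t = P-resp (λ u → sym (minus-plus (d u) t)) pd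
          x≤d-t = λ u → +-cancelʳ-≤ t (subst (_≤_ (x u + t)) (sym (minus-plus (d u) t)) (x+t≤d u))
      in trans (sym (minus-plus (d v) t)) (cong (λ z → z + t) (maximal d-t pd-t x≤d-t v))

-- From G to K(G)

module _ {n} (G : Graph (suc n)) where

  lift : (Fin n → ℤ) → Fin (suc n) → ℤ
  lift c v = addV0 (toDiv c) (- + 1) v + + 1

  -- Every vertex of G other than v₀ gains a chip, and v₀ carries none.
  deg-lift : ∀ c → deg (lift c) ≡ deg c + + n
  deg-lift c = trans (ℤP.+-identityˡ _) (weight-full c)

  -- Outside a set avoiding v₀, a vertex of G in K(G) also sees the new sink.
  out-K : ∀ (Y : Fin (suc n) → Bool) → Y zero ≡ false → ∀ v →
    out (K G) Y (suc v) ≡ + 1 + out G (λ u → Y (suc u)) v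
  out-K Y y₀ v = cong (_+_ (+ 1)) (∑-cong same-neighbour)
    where
      same-neighbour : ∀ w → [ adj G (suc v) w ∧ not (Y w) ] ≡ [ adj G (suc v) w ∧ not (ext (λ u → Y (suc u)) w) ]
      same-neighbour zero rewrite y₀ = refl
      same-neighbour (suc u) = refl

  -- A set firing from lift c avoids v₀ (which has no chips but an edge to the sink), and
  -- then it fires from c on G.
  lift-superstable : ∀ {c} → Superstable G c → Superstable (K G) (lift c)
  lift-superstable {c} (c≥0 , stuck) = lift≥0 , λ { (Y , ne , legal) → no-firing Y ne (legal⇒canFire (K G) Y legal) }
    where
      lift≥0 : ∀ v → + 0 ≤ lift c v
      lift≥0 zero = ℤP.≤-refl
      lift≥0 (suc u) = ℤP.≤-trans (c≥0 u) (ℤP.i≤i+j (c u) (+ 1))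
      no-firing : ∀ Y → Nonempty Y → ¬ CanFire (K G) (lift c) Y
      no-firing Y ne fire = v₀-cases (Y zero) refl
        where
          sink-edge : + 1 ≤ out (K G) Y zero
          sink-edge = ℤP.+-monoʳ-≤ (+ 1) (∑-nonneg (λ w → []-nonneg (adj G zero w ∧ not (Y w))))
          v₀-poor : ¬ (+ 1 ≤ lift c zero)
          v₀-poor (+≤+ ())
          Y' : Fin n → Bool
          Y' u = Y (suc u)
          v₀-cases : ∀ b → Y zero ≡ b → ⊥
          v₀-cases true y₀ = v₀-poor (ℤP.≤-trans sink-edge (fire zero y₀))
          v₀-cases false y₀ = stuck (Y' , ne' ne , canFire⇒legal G Y' c≥0 fire')
            where
              ne' : Nonempty Y → Nonempty Y'
              ne' (zero , yv) = contradiction (trans (sym yv) y₀) λ ()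
              ne' (suc v , yv) = v , yv
              fire' : CanFire G c Y'
              fire' v yv = +-cancelʳ-≤ (+ 1)
                (subst (_≤ c v + + 1) (trans (out-K Y y₀ v) (ℤP.+-comm (+ 1) (out G Y' v))) (fire (suc v) yv))

  lift-S0 : ∀ {c} → Superstable G c → S0 G (addV0 (toDiv c) (- + 1))
  lift-S0 ss = lift-superstable ss , refl , nonneg
    where nonneg : ∀ v → + 0 ≤ addV0 (addV0 (toDiv _) (- + 1)) (+ 1) v
          nonneg zero = ℤP.≤-refl
          nonneg (suc u) = proj₁ ss u

  -- K(G) has n + 1 more edges and lift c has n + 1 more chips than c (counting the
  -- extra vertex), so c is tight on G iff lift c is tight on K(G).
  tight-lift : ∀ c → (deg c + + n ≡ edgeCount G) ⇔ (deg (lift c) + + suc n ≡ edgeCount (K G))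
  tight-lift c = subst₂ (λ a b → (deg c + + n ≡ edgeCount G) ⇔ (a ≡ b))
                        (cong (λ z → z + + suc n) (sym (deg-lift c))) (sym (edgeCount-K G))
                        (+-cancelʳ-⇔ (+ suc n))

  -- c is maximal superstable on G iff c - v₀ is a maximal quasi-superstable divisor:
  -- both are the tightness equation, the latter after translating by 1_V.
  maximal-lift : ∀ {c} → Superstable G c → MaxSuperstable G c ⇔ MaxQuasiSuperstable G (addV0 (toDiv c) (- + 1))
  maximal-lift {c} ss =
    ⇔.trans (maximal⇔tight G ss)
    (⇔.trans (tight-lift c)
    (⇔.trans (⇔.sym (maximal⇔tight (K G) (lift-superstable ss)))
             (maximal-shift (Superstable (K G)) (superstable-resp (K G)) (+ 1) (addV0 (toDiv c) (- + 1)))))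

genus+n : ∀ {n} (G : Graph (suc n)) → genus G + + n ≡ edgeCount G
genus+n {n} G = rearrange (edgeCount G) (+ n)
  where rearrange : ∀ e k → e - (+ 1 + k) + + 1 + k ≡ e
        rearrange = solve-∀

-- Corollary 4.4.
corollary4p4 : ∀ {n} (G : Graph (suc n)) → Connected G →
    (c : Fin n → ℤ) → Superstable G c →
    (MaxSuperstable G c ⇔ (S0 G (addV0 (toDiv c) (- + 1)) × MaxQuasiSuperstable G (addV0 (toDiv c) (- + 1))))
    × (deg c ≤ genus G × (deg c ≡ genus G ⇔ MaxSuperstable G c))
corollary4p4 {n} G _ c ss = part1 , bound , tight⇔maximal
  where
    part1 : MaxSuperstable G c ⇔ (S0 G (addV0 (toDiv c) (- + 1)) × MaxQuasiSuperstable G (addV0 (toDiv c) (- + 1)))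
    part1 = mk⇔ (λ maximal → lift-S0 G ss , Equivalence.to (maximal-lift G ss) maximal)
                (λ (_ , qs) → Equivalence.from (maximal-lift G ss) qs)

    bound : deg c ≤ genus G
    bound = +-cancelʳ-≤ (+ n) (ℤP.≤-trans (superstable-bound G ss) (ℤP.≤-reflexive (sym (genus+n G))))

    tight⇔maximal : (deg c ≡ genus G) ⇔ MaxSuperstable G c
    tight⇔maximal = ⇔.trans (subst (λ e → (deg c ≡ genus G) ⇔ (deg c + + n ≡ e)) (genus+n G) (+-cancelʳ-⇔ (+ n)))
                            (⇔.sym (maximal⇔tight G ss))
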